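{- For every $a\in\mathbb{N}$, let $S(a)$ be the submonoid of $(\mathbb{N},+)$ generated by $\{f_a+f_n\mid n\in\mathbb{N}\}$. Then $\mathrm{F}(S(a))+1\leq \mathrm{e}(S(a))\,\mathrm{n}(S(a))$.
   Context: $\{f_n\}$ is the Fibonacci sequence ($f_0=0$, $f_1=1$, $f_{n+2}=f_{n+1}+f_n$). $S(a)$ is a numerical semigroup (for $a\in\{0,1,2\}$ it equals $\mathbb{N}$). For a numerical semigroup $S$: $\mathrm{F}(S)$ is the largest integer not in $S$ (with the usual convention $\mathrm{F}(\mathbb{N})=-1$); $\mathrm{e}(S)$ (embedding dimension) is the cardinality of the unique minimal system of generators of $S$; $\mathrm{n}(S)$ is the cardinality of $\{s\in S\mid s<\mathrm{F}(S)\}$. -}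

module Defs where

open import Data.Nat using (ℕ; zero; suc; _+_; _<_)
open import Data.Integer as ℤ using (ℤ; +_)
open import Data.Product using (Σ; ∃; _×_; _,_)
open import Data.List using (List; length)
open import Data.List.Membership.Propositional using (_∈_)
open import Data.List.Relation.Binary.Subset.Propositional using (_⊆_)
open import Data.List.Relation.Unary.Unique.Propositional using (Unique)
open import Relation.Binary.PropositionalEquality using (_≡_)
open import Relation.Nullary using (¬_)
open import Function.Bundles using (_⇔_)

fib : ℕ → ℕ
fib zero = 0
fib (suc zero) = 1
fib (suc (suc n)) = fib (suc n) + fib n

Subset : Set₁
Subset = ℕ → Set

data Gen (A : Subset) : ℕ → Set where
  gen-zero : Gen A 0
  gen-add  : ∀ {g x} → A g → Gen A x → Gen A (g + x)

GenL : List ℕ → Subset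
GenL L = Gen (λ g → g ∈ L)

S : ℕ → Subset
S a = Gen (λ x → ∃ λ n → x ≡ fib a + fib n)

InZ : Subset → ℤ → Set
InZ T z = Σ ℕ λ m → (z ≡ + m) × T m

-- F is the Frobenius number of T: the largest integer not in T.
-- (For T = ℕ this forces F = -1, matching the usual convention.)
IsFrobenius : Subset → ℤ → Set
IsFrobenius T F = ¬ InZ T F × (∀ z → F ℤ.< z → InZ T z)

HasCard : Subset → ℕ → Set
HasCard P k = Σ (List ℕ) λ L → Unique L × (∀ x → (x ∈ L) ⇔ P x) × (length L ≡ k)

IsMinimalSystemOfGenerators : Subset → List ℕ → Set
IsMinimalSystemOfGenerators T L =
  Unique L × (∀ x → GenL L x ⇔ T x) ×
  (∀ (L' : List ℕ) → L' ⊆ L → (∀ x → T x → GenL L' x) → L ⊆ L')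

IsEmbeddingDimension : Subset → ℕ → Set
IsEmbeddingDimension T e = Σ (List ℕ) λ L → IsMinimalSystemOfGenerators T L × (length L ≡ e)

IsSmallElementsCount : Subset → ℤ → ℕ → Set
IsSmallElementsCount T F k = HasCard (λ s → T s × (+ s) ℤ.< F) k

{-# OPTIONS --safe #-}
-- Write m = f_a with a ≥ 3, and let w(x) be the number of terms of the Zeckendorf
-- representation of x < m. Then S(a) consists exactly of the numbers x + k·m with
-- x < m and w(x) ≤ k: this form survives adding a generator m + f_n because adding
-- f_n costs at most one Zeckendorf term and a carry past m costs none. As w is at
-- most c = ⌊(a-1)/2⌋, with equality at m - 1, the Frobenius number is c·m - 1.
-- The generators m and m + f_i (2 ≤ i < a) lie below 2m, so none can be omitted and
-- e ≥ a - 1. The numbers x + ⌊(b-1)/2⌋·m with x < f_b, for b = a-2, a-4, ..., lie in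
-- S(a) below the Frobenius number, so n ≥ f_{a-2} + f_{a-4} + ⋯. Since 2c ≤ a - 1
-- and, for a ≥ 5, m ≤ 2(f_{a-2} + f_{a-4} + ⋯), this gives c·m ≤ e·n (a = 3, 4 are
-- checked directly). For a ≤ 2, S(a) = ℕ.
module Submission where

open import Defs
open import Data.Bool using (true; false; if_then_else_)
open import Data.Fin using (Fin; zero; suc)
open import Data.Fin.Properties using (injective⇒≤)
open import Data.Integer using (ℤ; +_; -[1+_])
import Data.Integer as ℤ
import Data.Integer.Properties as ℤ
open import Data.List using (List; []; _∷_; _++_; length; lookup; map; upTo)
open import Data.List.Membership.Propositional using (_∈_)
open import Data.List.Membership.Propositional.Properties using (∈-lookup; ∈-map⁻; ∈-upTo⁻; ∈-++⁻)
open import Data.List.Properties using (length-map; length-++; length-upTo)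
open import Data.List.Relation.Binary.Subset.Propositional using (_⊆_)
import Data.List.Relation.Unary.All as All
open import Data.List.Relation.Unary.Any as Any using (here; there)
open import Data.List.Relation.Unary.Any.Properties using (lookup-index)
open import Data.List.Relation.Unary.AllPairs using ([]; _∷_)
open import Data.List.Relation.Unary.Unique.Propositional using (Unique)
open import Data.List.Relation.Unary.Unique.Propositional.Properties using (map⁺; ++⁺; upTo⁺)
open import Data.Nat
open import Data.Nat.DivMod using (_%_; _/_; m<n⇒m%n≡m; [m+kn]%n≡m%n; m≡m%n+[m/n]*n; m%n<n; m*n/n≡m; /-monoˡ-≤)
open import Data.Nat.Induction using (<-rec)
open import Data.Nat.Properties
open import Data.Nat.Tactic.RingSolver using (solve-∀)
open import Data.Product using (∃; _×_; _,_; proj₁; proj₂)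
open import Data.Sum using (_⊎_; inj₁; inj₂)
open import Function.Bundles using (_⇔_; Equivalence)
open import Relation.Binary.Definitions using (tri<; tri≈; tri>)
open import Relation.Binary.PropositionalEquality
open import Relation.Nullary using (¬_; yes; no; contradiction; ofʸ; ofⁿ)

open ≤-Reasoning

fib-≤-suc : ∀ n → fib n ≤ fib (suc n)
fib-≤-suc zero    = z≤n
fib-≤-suc (suc n) = m≤m+n _ _

fib-mono-≤ : ∀ {n n'} → n ≤ n' → fib n ≤ fib n'
fib-mono-≤ {n' = zero}   z≤n = ≤-refl
fib-mono-≤ {n' = suc n'} n≤ with m≤n⇒m<n∨m≡n n≤
... | inj₁ n<  = ≤-trans (fib-mono-≤ (m<1+n⇒m≤n n<)) (fib-≤-suc n')
... | inj₂ refl = ≤-refl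

fib-suc-pos : ∀ n → 0 < fib (suc n)
fib-suc-pos zero    = z<s
fib-suc-pos (suc n) = <-≤-trans (fib-suc-pos n) (m≤m+n _ _)

fib-<-suc : ∀ n → fib (suc (suc n)) < fib (suc (suc (suc n)))
fib-<-suc n = m<m+n (fib (suc (suc n))) (fib-suc-pos n)

fib-2+-strictMono : ∀ {i j} → i < j → fib (2 + i) < fib (2 + j)
fib-2+-strictMono {i} {suc j} (s≤s i≤j) = ≤-<-trans (fib-mono-≤ (s≤s (s≤s i≤j))) (fib-<-suc j)

fib-2+-injective : ∀ {i j} → fib (2 + i) ≡ fib (2 + j) → i ≡ j
fib-2+-injective {i} {j} eq with <-cmp i j
... | tri< i<j _ _ = contradiction eq (<⇒≢ (fib-2+-strictMono i<j))
... | tri≈ _ i≡j _ = i≡j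
... | tri> _ _ j<i = contradiction (sym eq) (<⇒≢ (fib-2+-strictMono j<i))

⌊n/2⌋+⌊n/2⌋≤n : ∀ n → ⌊ n /2⌋ + ⌊ n /2⌋ ≤ n
⌊n/2⌋+⌊n/2⌋≤n n = ≤-trans (+-monoʳ-≤ ⌊ n /2⌋ (⌊n/2⌋≤⌈n/2⌉ n)) (≤-reflexive (⌊n/2⌋+⌈n/2⌉≡n n))

+-*-unique : ∀ {m x x' k k'} → x < m → x' < m → x + k * m ≡ x' + k' * m → x ≡ x' × k ≡ k'
+-*-unique {m} {x} {x'} {k} {k'} x< x'< eq =
  x≡x' , *-cancelʳ-≡ k k' m (+-cancelˡ-≡ x _ _ (trans eq (cong (_+ k' * m) (sym x≡x'))))
  where
    instance
      m-nonZero : NonZero m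
      m-nonZero = >-nonZero (<-≤-trans z<s x<)
    x≡x' : x ≡ x'
    x≡x' = begin-equality
      x                 ≡⟨ m<n⇒m%n≡m x< ⟨
      x % m             ≡⟨ [m+kn]%n≡m%n x k m ⟨
      (x + k * m) % m   ≡⟨ cong (_% m) eq ⟩
      (x' + k' * m) % m ≡⟨ [m+kn]%n≡m%n x' k' m ⟩
      x' % m            ≡⟨ m<n⇒m%n≡m x'< ⟩
      x'                ∎

data Split (p : ℕ) : ℕ → Set where
  below : ∀ {x} → x < p → Split p x
  above : ∀ {x} y → x ≡ p + y → Split p x

split : ∀ p x → Split p x
split p x with p ≤? x
... | yes p≤x = above (x ∸ p) (sym (m+[n∸m]≡n p≤x))
... | no p≰x  = below (≰⇒> p≰x)

lookup-injective : ∀ {A : Set} {xs : List A} → Unique xs → ∀ {i j} → lookup xs i ≡ lookup xs j → i ≡ j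
lookup-injective (_ ∷ _)  {zero}  {zero}  _  = refl
lookup-injective (x∉ ∷ _) {zero}  {suc j} eq = contradiction eq (All.lookup x∉ (∈-lookup j))
lookup-injective (x∉ ∷ _) {suc i} {zero}  eq = contradiction (sym eq) (All.lookup x∉ (∈-lookup i))
lookup-injective (_ ∷ u)  {suc i} {suc j} eq = cong suc (lookup-injective u eq)

Unique-⊆⇒length≤ : ∀ {A : Set} {xs ys : List A} → Unique xs → xs ⊆ ys → length xs ≤ length ys
Unique-⊆⇒length≤ {xs = xs} {ys} u xs⊆ys = injective⇒≤ position-injective
  where
    position : Fin (length xs) → Fin (length ys)
    position i = Any.index (xs⊆ys (∈-lookup i))
    lookup-position : ∀ i → lookup xs i ≡ lookup ys (position i)
    lookup-position i = lookup-index (xs⊆ys (∈-lookup i))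
    position-injective : ∀ {i j} → position i ≡ position j → i ≡ j
    position-injective {i} {j} eq =
      lookup-injective u (trans (lookup-position i) (trans (cong (lookup ys) eq) (sym (lookup-position j))))

Gen-generator : ∀ {P : Subset} {g} → P g → Gen P g
Gen-generator {g = g} p = subst (Gen _) (+-identityʳ g) (gen-add p gen-zero)

Gen-+ : ∀ {P : Subset} {x y} → Gen P x → Gen P y → Gen P (x + y)
Gen-+           gen-zero              q = q
Gen-+ {y = y} (gen-add {g} {x} p q) r = subst (Gen _) (sym (+-assoc g x y)) (gen-add p (Gen-+ q r))

Gen-all : ∀ {P : Subset} → P 1 → ∀ y → Gen P y
Gen-all p zero    = gen-zero
Gen-all p (suc y) = gen-add p (Gen-all p y)

Gen-zero-or-≥ : ∀ {P : Subset} {m x} → (∀ {g} → P g → g ≡ 0 ⊎ m ≤ g) → Gen P x → x ≡ 0 ⊎ m ≤ x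
Gen-zero-or-≥ P-bound gen-zero = inj₁ refl
Gen-zero-or-≥ P-bound (gen-add {g} {x} p q) with P-bound p | Gen-zero-or-≥ P-bound q
... | inj₁ refl | q-bound    = q-bound
... | inj₂ m≤g  | _          = inj₂ (≤-trans m≤g (m≤m+n g x))

-- A nonzero element below 2m cannot be a sum of two nonzero elements.
Gen-small⇒generator : ∀ {P : Subset} {m v} → (∀ {g} → P g → g ≡ 0 ⊎ m ≤ g) →
                      Gen P v → 0 < v → v < m + m → P v
Gen-small⇒generator {P} P-bound (gen-add {g} {x} p q) 0<v v<2m with P-bound p | Gen-zero-or-≥ P-bound q
... | inj₁ refl | _        = Gen-small⇒generator P-bound q 0<v v<2m
... | inj₂ _    | inj₁ refl = subst P (sym (+-identityʳ g)) p
... | inj₂ m≤g  | inj₂ m≤x  = contradiction (+-mono-≤ m≤g m≤x) (<⇒≱ v<2m)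

InZ-+ : ∀ {T : Subset} {x} → InZ T (+ x) → T x
InZ-+ (_ , refl , t) = t

-- weight b x is the number of terms of the greedy (Zeckendorf) representation
-- of x < fib b as a sum of Fibonacci numbers fib i with 2 ≤ i < b.
weight : ℕ → ℕ → ℕ
weight zero          x = 0
weight (suc zero)    x = 0
weight (suc (suc b)) x =
  if fib (suc b) ≤ᵇ x then suc (weight b (x ∸ fib (suc b))) else weight (suc b) x

weight-fib+ : ∀ b x → weight (suc (suc b)) (fib (suc b) + x) ≡ suc (weight b x)
weight-fib+ b x with fib (suc b) ≤ᵇ fib (suc b) + x | ≤ᵇ-reflects-≤ (fib (suc b)) (fib (suc b) + x)
... | true  | ofʸ _    = cong (λ z → suc (weight b z)) (m+n∸m≡n (fib (suc b)) x)
... | false | ofⁿ fib≰ = contradiction (m≤m+n (fib (suc b)) x) fib≰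

weight-<fib : ∀ b {x} → x < fib (suc b) → weight (suc (suc b)) x ≡ weight (suc b) x
weight-<fib b {x} x< with fib (suc b) ≤ᵇ x | ≤ᵇ-reflects-≤ (fib (suc b)) x
... | true  | ofʸ fib≤x = contradiction fib≤x (<⇒≱ x<)
... | false | ofⁿ _     = refl

weight-suc : ∀ b {x} → x < fib b → weight (suc b) x ≡ weight b x
weight-suc (suc b) = weight-<fib b

weight-stable : ∀ {b b' x} → b ≤ b' → x < fib b → weight b' x ≡ weight b x
weight-stable {b' = zero}   z≤n _  = refl
weight-stable {b} {suc b'} b≤b' x< with m≤n⇒m<n∨m≡n b≤b'
... | inj₂ refl = refl
... | inj₁ b<   = trans (weight-suc b' (<-≤-trans x< (fib-mono-≤ (m<1+n⇒m≤n b<))))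
                        (weight-stable (m<1+n⇒m≤n b<) x<)

weight-zero : ∀ b → weight b 0 ≡ 0
weight-zero zero          = refl
weight-zero (suc zero)    = refl
weight-zero (suc (suc b)) = trans (weight-<fib b (fib-suc-pos b)) (weight-zero (suc b))

AddFibBound : ℕ → Set
AddFibBound b = ∀ x n → n < b → x + fib n < fib b → weight b (x + fib n) ≤ suc (weight b x)

CarryBound : ℕ → Set
CarryBound b = ∀ x n y → x < fib b → n < b → x + fib n ≡ fib b + y → weight b y ≤ weight b x

weight-+fib-step : ∀ b → AddFibBound b → AddFibBound (suc b) → CarryBound (suc b) →
                   AddFibBound (suc (suc b))
weight-+fib-step b addFib addFib₁ carry₁ x n n< s< with m<1+n⇒m<n∨m≡n n<
... | inj₂ refl = ≤-reflexive (begin-equality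
  weight (2 + b) (x + fib (1 + b))  ≡⟨ cong (weight (2 + b)) (+-comm x _) ⟩
  weight (2 + b) (fib (1 + b) + x)  ≡⟨ weight-fib+ b x ⟩
  suc (weight b x)                  ≡⟨ cong suc (weight-stable (m≤n+m b 2) x<F2) ⟨
  suc (weight (2 + b) x)            ∎)
  where
    x<F2 : x < fib b
    x<F2 = +-cancelʳ-< (fib (1 + b)) x (fib b) (subst (x + fib (1 + b) <_) (+-comm _ (fib b)) s<)
... | inj₁ n<1+b with split (fib (1 + b)) x
...   | above x' refl = begin
  weight (2 + b) (fib (1 + b) + x' + fib n)    ≡⟨ cong (weight (2 + b)) (+-assoc (fib (1 + b)) x' (fib n)) ⟩
  weight (2 + b) (fib (1 + b) + (x' + fib n))  ≡⟨ weight-fib+ b (x' + fib n) ⟩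
  suc (weight b (x' + fib n))                  ≤⟨ s≤s (addFib x' n n<b s'<F2) ⟩
  suc (suc (weight b x'))                      ≡⟨ cong suc (weight-fib+ b x') ⟨
  suc (weight (2 + b) (fib (1 + b) + x'))      ∎
  where
    s'<F2 : x' + fib n < fib b
    s'<F2 = +-cancelˡ-< (fib (1 + b)) _ _ (subst (_< fib (2 + b)) (+-assoc (fib (1 + b)) x' (fib n)) s<)
    n<b : n < b
    n<b with m<1+n⇒m<n∨m≡n n<1+b
    ... | inj₁ n<b  = n<b
    ... | inj₂ refl = contradiction s'<F2 (m+n≮n x' (fib b))
...   | below x<F1 with split (fib (1 + b)) (x + fib n)
...     | below s<F1 = begin
  weight (2 + b) (x + fib n)  ≡⟨ weight-<fib b s<F1 ⟩
  weight (1 + b) (x + fib n)  ≤⟨ addFib₁ x n n<1+b s<F1 ⟩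
  suc (weight (1 + b) x)      ≡⟨ cong suc (weight-<fib b x<F1) ⟨
  suc (weight (2 + b) x)      ∎
...     | above y s≡ = begin
  weight (2 + b) (x + fib n)       ≡⟨ cong (weight (2 + b)) s≡ ⟩
  weight (2 + b) (fib (1 + b) + y) ≡⟨ weight-fib+ b y ⟩
  suc (weight b y)                 ≡⟨ cong suc (weight-suc b y<F2) ⟨
  suc (weight (1 + b) y)           ≤⟨ s≤s (carry₁ x n y x<F1 n<1+b s≡) ⟩
  suc (weight (1 + b) x)           ≡⟨ cong suc (weight-<fib b x<F1) ⟨
  suc (weight (2 + b) x)           ∎
  where
    y<F2 : y < fib b
    y<F2 = +-cancelˡ-< (fib (1 + b)) _ _ (subst (_< fib (2 + b)) s≡ s<)

weight-carry-top : ∀ b → AddFibBound (suc b) → ∀ x y → x < fib (2 + b) →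
                   x + fib (1 + b) ≡ fib (2 + b) + y → weight (2 + b) y ≤ weight (2 + b) x
weight-carry-top zero _ zero    .zero _         refl = ≤-refl
weight-carry-top zero _ (suc x) y     (s≤s ()) _
weight-carry-top (suc b) addFib₁ x y x< eq with split (fib (2 + b)) x
... | above x' refl = begin
  weight (3 + b) y                  ≡⟨ cong (weight (3 + b)) y≡ ⟩
  weight (3 + b) (x' + fib b)       ≡⟨ weight-<fib (1 + b) (+-monoˡ-< (fib b) x'<F2) ⟩
  weight (2 + b) (x' + fib b)       ≤⟨ addFib₁ x' b (m<n+m b z<s) (+-monoˡ-< (fib b) x'<F2) ⟩
  suc (weight (2 + b) x')           ≡⟨ cong suc (weight-suc (1 + b) x'<F2) ⟩
  suc (weight (1 + b) x')           ≡⟨ weight-fib+ (1 + b) x' ⟨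
  weight (3 + b) (fib (2 + b) + x') ∎
  where
    x'<F2 : x' < fib (1 + b)
    x'<F2 = +-cancelˡ-< (fib (2 + b)) x' (fib (1 + b)) x<
    shuffle : ∀ F₁ F₂ F₃ x' → F₁ + x' + (F₂ + F₃) ≡ F₁ + F₂ + (x' + F₃)
    shuffle = solve-∀
    y≡ : y ≡ x' + fib b
    y≡ = +-cancelˡ-≡ (fib (3 + b)) _ _ (trans (sym eq) (shuffle (fib (2 + b)) (fib (1 + b)) (fib b) x'))
... | below x<F1 = begin
  weight (3 + b) y                  ≡⟨ weight-stable (m≤n+m b 3) y<F3 ⟩
  weight b y                        ≤⟨ n≤1+n _ ⟩
  suc (weight b y)                  ≡⟨ weight-fib+ b y ⟨
  weight (2 + b) (fib (1 + b) + y)  ≡⟨ cong (weight (2 + b)) x≡ ⟨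
  weight (2 + b) x                  ≡⟨ weight-<fib (1 + b) x<F1 ⟨
  weight (3 + b) x                  ∎
  where
    x≡ : x ≡ fib (1 + b) + y
    x≡ = +-cancelʳ-≡ (fib (2 + b)) _ _
           (trans eq (trans (+-assoc (fib (2 + b)) (fib (1 + b)) y) (+-comm (fib (2 + b)) _)))
    y<F3 : y < fib b
    y<F3 = +-cancelˡ-< (fib (1 + b)) y (fib b) (subst (_< fib (2 + b)) x≡ x<F1)

weight-carry-step : ∀ b → CarryBound b → AddFibBound (suc b) → CarryBound (suc (suc b))
weight-carry-step b carry addFib₁ x n y x< n< eq with m<1+n⇒m<n∨m≡n n<
... | inj₂ refl = weight-carry-top b addFib₁ x y x< eq
... | inj₁ n<1+b with split (fib (1 + b)) x
...   | below x<F1 = contradiction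
        (subst (_< fib (2 + b)) eq (+-mono-<-≤ x<F1 (fib-mono-≤ (m<1+n⇒m≤n n<1+b))))
        (m+n≮m (fib (2 + b)) y)
...   | above x' refl = begin
  weight (2 + b) y                  ≡⟨ weight-stable (m≤n+m b 2) y<F2 ⟩
  weight b y                        ≤⟨ y≤x' ⟩
  weight b x'                       ≤⟨ n≤1+n _ ⟩
  suc (weight b x')                 ≡⟨ weight-fib+ b x' ⟨
  weight (2 + b) (fib (1 + b) + x') ∎
  where
    x'<F2 : x' < fib b
    x'<F2 = +-cancelˡ-< (fib (1 + b)) x' (fib b) x<
    eq' : x' + fib n ≡ fib b + y
    eq' = +-cancelˡ-≡ (fib (1 + b)) _ _
            (trans (sym (+-assoc (fib (1 + b)) x' (fib n))) (trans eq (+-assoc (fib (1 + b)) (fib b) y)))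
    y<F2 : y < fib b
    y<F2 = <-≤-trans (+-cancelˡ-< (fib b) y (fib n) (subst (_< fib b + fib n) eq' (+-monoˡ-< (fib n) x'<F2)))
                     (fib-mono-≤ (m<1+n⇒m≤n n<1+b))
    y≤x' : weight b y ≤ weight b x'
    y≤x' with m<1+n⇒m<n∨m≡n n<1+b
    ... | inj₁ n<b  = carry x' n y x'<F2 n<b eq'
    ... | inj₂ refl = ≤-reflexive (cong (weight b) (+-cancelˡ-≡ (fib b) _ _ (trans (sym eq') (+-comm x' (fib b)))))

weight-bounds : ∀ b → AddFibBound b × CarryBound b
weight-bounds = <-rec (λ b → AddFibBound b × CarryBound b) bounds
  where
    bounds : ∀ b → (∀ {b'} → b' < b → AddFibBound b' × CarryBound b') → AddFibBound b × CarryBound b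
    bounds zero          _   = (λ _ _ ()) , (λ _ _ _ _ ())
    bounds (suc zero)    _   = (λ _ _ _ _ → z≤n) , (λ _ _ _ _ _ _ → z≤n)
    bounds (suc (suc b)) rec with rec (m<n+m b {2} z<s) | rec ≤-refl
    ... | addFib , carry | addFib₁ , carry₁ =
      weight-+fib-step b addFib addFib₁ carry₁ , weight-carry-step b carry addFib₁

weight-+fib : ∀ b → AddFibBound b
weight-+fib b = proj₁ (weight-bounds b)

weight-carry : ∀ b → CarryBound b
weight-carry b = proj₂ (weight-bounds b)

maxWeight : ℕ → ℕ
maxWeight b = ⌊ b ∸ 1 /2⌋

WeightBounded : ℕ → Set
WeightBounded b = ∀ {x} → x < fib b → weight b x ≤ maxWeight b

weight≤maxWeight : ∀ b → WeightBounded b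
weight≤maxWeight = <-rec WeightBounded bound
  where
    bound : ∀ b → (∀ {b'} → b' < b → WeightBounded b') → WeightBounded b
    bound (suc zero)          _   _  = z≤n
    bound (suc (suc zero))    _   {zero}  _        = z≤n
    bound (suc (suc zero))    _   {suc x} (s≤s ())
    bound (suc (suc (suc b))) rec {x} x< with split (fib (2 + b)) x
    ... | below x<F1 = begin
      weight (3 + b) x  ≡⟨ weight-<fib (suc b) x<F1 ⟩
      weight (2 + b) x  ≤⟨ rec ≤-refl x<F1 ⟩
      maxWeight (2 + b) ≤⟨ ⌊n/2⌋-mono (n≤1+n (suc b)) ⟩
      maxWeight (3 + b) ∎
    ... | above x' refl = begin
      weight (3 + b) (fib (2 + b) + x') ≡⟨ weight-fib+ (suc b) x' ⟩
      suc (weight (1 + b) x')           ≤⟨ s≤s (rec (m<n+m (suc b) {2} z<s) (+-cancelˡ-< (fib (2 + b)) x' _ x<)) ⟩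
      maxWeight (3 + b)                 ∎

weight-fib∸1 : ∀ b → weight b (fib b ∸ 1) ≡ maxWeight b
weight-fib∸1 zero                = refl
weight-fib∸1 (suc zero)          = refl
weight-fib∸1 (suc (suc zero))    = refl
weight-fib∸1 (suc (suc (suc b))) = begin-equality
  weight (3 + b) (fib (2 + b) + fib (1 + b) ∸ 1)   ≡⟨ cong (weight (3 + b)) (+-∸-assoc (fib (2 + b)) (fib-suc-pos b)) ⟩
  weight (3 + b) (fib (2 + b) + (fib (1 + b) ∸ 1)) ≡⟨ weight-fib+ (suc b) _ ⟩
  suc (weight (1 + b) (fib (1 + b) ∸ 1))           ≡⟨ cong suc (weight-fib∸1 (suc b)) ⟩
  maxWeight (3 + b)                                ∎

S-generator : ∀ a n → S a (fib a + fib n)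
S-generator a n = Gen-generator (n , refl)

S-multiple : ∀ a k → S a (k * fib a)
S-multiple a zero    = gen-zero
S-multiple a (suc k) = Gen-+ (subst (S a) (+-identityʳ (fib a)) (S-generator a 0)) (S-multiple a k)

S-zero-or-≥ : ∀ a {x} → S a x → x ≡ 0 ⊎ fib a ≤ x
S-zero-or-≥ a = Gen-zero-or-≥ λ { (n , refl) → inj₂ (m≤m+n (fib a) (fib n)) }

S-weight : ∀ a b {x k} → x < fib b → weight b x ≤ k → S a (x + k * fib a)
S-weight a = <-rec Claim step
  where
    Claim : ℕ → Set
    Claim b = ∀ {x k} → x < fib b → weight b x ≤ k → S a (x + k * fib a)
    step : ∀ b → (∀ {b'} → b' < b → Claim b') → Claim b
    step (suc zero)    _   {zero}  {k} _        _ = S-multiple a k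
    step (suc zero)    _   {suc x}     (s≤s ()) _
    step (suc (suc b)) rec {x} x< w≤k with split (fib (suc b)) x
    ... | below x<F1    = rec ≤-refl x<F1 (subst (_≤ _) (weight-<fib b x<F1) w≤k)
    ... | above x' refl = add-generator (subst (_≤ _) (weight-fib+ b x') w≤k)
      where
        shuffle : ∀ F m x' k → F + x' + (m + k * m) ≡ (m + F) + (x' + k * m)
        shuffle = solve-∀
        add-generator : ∀ {k} → suc (weight b x') ≤ k → S a (fib (suc b) + x' + k * fib a)
        add-generator {suc k} (s≤s w≤k) =
          subst (S a) (sym (shuffle (fib (suc b)) (fib a) x' k))
            (Gen-+ (S-generator a (suc b)) (rec (m<n+m b {2} z<s) (+-cancelˡ-< (fib (suc b)) x' (fib b) x<) w≤k))

record Canonical (a y : ℕ) : Set where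
  constructor canonical
  field
    remainder quotient : ℕ
    y≡            : y ≡ remainder + quotient * fib a
    remainder<fib : remainder < fib a
    weight≤       : weight a remainder ≤ quotient

Canonical⇒S : ∀ a {y} → Canonical a y → S a y
Canonical⇒S a (canonical x k refl x< w≤k) = S-weight a a x< w≤k

Canonical-+generator : ∀ a {y} n → n < a → Canonical a y → Canonical a (fib a + fib n + y)
Canonical-+generator a n n<a (canonical x k refl x< w≤k) with split (fib a) (x + fib n)
... | below s< = canonical (x + fib n) (suc k) (shuffle (fib a) (fib n) x k) s<
                   (≤-trans (weight-+fib a x n n<a s<) (s≤s w≤k))
  where
    shuffle : ∀ m f x k → m + f + (x + k * m) ≡ x + f + (m + k * m)
    shuffle = solve-∀
... | above y s≡ = canonical y (2 + k) carried y<m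
                     (≤-trans (weight-carry a x n y x< n<a s≡) (≤-trans w≤k (m≤n+m k 2)))
  where
    m = fib a
    shuffle₁ : ∀ m f x k → m + f + (x + k * m) ≡ x + f + (m + k * m)
    shuffle₁ = solve-∀
    shuffle₂ : ∀ m y k → m + y + (m + k * m) ≡ y + (m + (m + k * m))
    shuffle₂ = solve-∀
    carried : m + fib n + (x + k * m) ≡ y + (2 + k) * m
    carried = begin-equality
      m + fib n + (x + k * m)  ≡⟨ shuffle₁ m (fib n) x k ⟩
      x + fib n + (m + k * m)  ≡⟨ cong (_+ (m + k * m)) s≡ ⟩
      m + y + (m + k * m)      ≡⟨ shuffle₂ m y k ⟩
      y + (2 + k) * m          ∎
    y<m : y < m
    y<m = +-cancelˡ-< m y m (subst (_< m + m) s≡ (+-mono-<-≤ x< (fib-mono-≤ (<⇒≤ n<a))))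

Canonical-+fib : ∀ a {y} d → Canonical (suc a) y → Canonical (suc a) (fib (d + suc a) + y)
Canonical-+fib a zero c =
  subst (λ z → Canonical (suc a) (z + _)) (+-identityʳ (fib (suc a))) (Canonical-+generator (suc a) 0 z<s c)
Canonical-+fib a (suc zero) c = Canonical-+generator (suc a) a ≤-refl c
Canonical-+fib a {y} (suc (suc d)) c =
  subst (Canonical (suc a)) (sym (+-assoc (fib (suc d + suc a)) (fib (d + suc a)) y))
    (Canonical-+fib a (suc d) (Canonical-+fib a d c))

S⇒Canonical : ∀ a {y} → S (suc a) y → Canonical (suc a) y
S⇒Canonical a gen-zero = canonical 0 0 refl (fib-suc-pos a) (≤-reflexive (weight-zero (suc a)))
S⇒Canonical a (gen-add {x = y} (n , refl) s) with n <? suc a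
... | yes n<a = Canonical-+generator (suc a) n n<a (S⇒Canonical a s)
... | no n≮a  = subst (Canonical (suc a)) reassociate
                  (Canonical-+fib a 0 (Canonical-+fib a (n ∸ suc a) (S⇒Canonical a s)))
  where
    reassociate : fib (suc a) + (fib (n ∸ suc a + suc a) + y) ≡ fib (suc a) + fib n + y
    reassociate = trans (cong (λ i → fib (suc a) + (fib i + y)) (m∸n+n≡m (≮⇒≥ n≮a)))
                        (sym (+-assoc (fib (suc a)) (fib n) y))

S-≥maxWeight* : ∀ a {y} → maxWeight (suc a) * fib (suc a) ≤ y → S (suc a) y
S-≥maxWeight* a {y} c*m≤y = Canonical⇒S (suc a)
  (canonical (y % m) (y / m) (m≡m%n+[m/n]*n y m) (m%n<n y m)
    (≤-trans (weight≤maxWeight (suc a) (m%n<n y m)) c≤y/m))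
  where
    m = fib (suc a)
    instance
      m-nonZero : NonZero m
      m-nonZero = >-nonZero (fib-suc-pos a)
    c≤y/m : maxWeight (suc a) ≤ y / m
    c≤y/m = subst (_≤ y / m) (m*n/n≡m (maxWeight (suc a)) m) (/-monoˡ-≤ m c*m≤y)

S-∌frobenius : ∀ b → ¬ S (3 + b) (fib (3 + b) ∸ 1 + maxWeight (1 + b) * fib (3 + b))
S-∌frobenius b s with S⇒Canonical (2 + b) s
... | canonical x k eq x< w≤k
    with +-*-unique {k = maxWeight (1 + b)} {k' = k} (∸-monoʳ-< z<s (fib-suc-pos (2 + b))) x< eq
...   | refl , refl = contradiction (subst (_≤ k) (weight-fib∸1 (3 + b)) w≤k) (n≮n k)

atoms : ℕ → List ℕ
atoms c = fib (2 + c) ∷ map (λ i → fib (2 + c) + fib (2 + i)) (upTo c)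

atoms-unique : ∀ c → Unique (atoms c)
atoms-unique c =
  All.tabulate m≢ ∷ map⁺ (λ eq → fib-2+-injective (+-cancelˡ-≡ (fib (2 + c)) _ _ eq)) (upTo⁺ c)
  where
    m≢ : ∀ {v} → v ∈ map (λ i → fib (2 + c) + fib (2 + i)) (upTo c) → fib (2 + c) ≢ v
    m≢ v∈ with ∈-map⁻ _ v∈
    ... | i , _ , refl = <⇒≢ (m<m+n (fib (2 + c)) (fib-suc-pos (suc i)))

atom-bounds : ∀ c {v} → v ∈ atoms c → S (2 + c) v × 0 < v × v < fib (2 + c) + fib (2 + c)
atom-bounds c (here refl) =
  subst (S (2 + c)) (+-identityʳ _) (S-generator (2 + c) 0) , fib-suc-pos (suc c) , m<m+n _ (fib-suc-pos (suc c))
atom-bounds c (there v∈) with ∈-map⁻ _ v∈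
... | i , i∈ , refl =
  S-generator (2 + c) (2 + i) , <-≤-trans (fib-suc-pos (suc c)) (m≤m+n _ _) ,
  +-monoʳ-< (fib (2 + c)) (fib-2+-strictMono (∈-upTo⁻ i∈))

embeddingDimension≥ : ∀ c {e} → IsEmbeddingDimension (S (2 + c)) e → suc c ≤ e
embeddingDimension≥ c (L , (_ , L-generates , _) , refl) =
  subst (_≤ length L) length-atoms (Unique-⊆⇒length≤ (atoms-unique c) atoms⊆L)
  where
    length-atoms : length (atoms c) ≡ suc c
    length-atoms = cong suc (trans (length-map _ (upTo c)) (length-upTo c))
    L-bound : ∀ {g} → g ∈ L → g ≡ 0 ⊎ fib (2 + c) ≤ g
    L-bound g∈L = S-zero-or-≥ (2 + c) (Equivalence.to (L-generates _) (Gen-generator g∈L))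
    atoms⊆L : atoms c ⊆ L
    atoms⊆L v∈ with atom-bounds c v∈
    ... | s , 0<v , v<2m = Gen-small⇒generator L-bound (Equivalence.from (L-generates _) s) 0<v v<2m

row : ℕ → ℕ → List ℕ
row m b = map (_+ maxWeight b * m) (upTo (fib b))

row-bounds : ∀ m b {z} → z ∈ row m b → ∃ λ x → x < fib b × z ≡ x + maxWeight b * m
row-bounds m b z∈ with ∈-map⁻ _ z∈
... | x , x∈ , refl = x , ∈-upTo⁻ x∈ , refl

row⊆S : ∀ a b {z} → z ∈ row (fib a) b → S a z
row⊆S a b z∈ with row-bounds (fib a) b z∈
... | x , x< , refl = S-weight a b x< (weight≤maxWeight b x<)

row-< : ∀ m b {z} → z ∈ row m b → z < fib b + maxWeight b * m
row-< m b z∈ with row-bounds m b z∈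
... | x , x< , refl = +-monoˡ-< (maxWeight b * m) x<

row-≥ : ∀ m b {z} → z ∈ row m b → maxWeight b * m ≤ z
row-≥ m b z∈ with row-bounds m b z∈
... | x , _ , refl = m≤n+m (maxWeight b * m) x

row-unique : ∀ m b → Unique (row m b)
row-unique m b = map⁺ (λ {x} {y} → +-cancelʳ-≡ (maxWeight b * m) x y) (upTo⁺ (fib b))

fib+maxWeight*≤ : ∀ {m} b → fib b ≤ m → fib b + maxWeight b * m ≤ maxWeight (2 + b) * m
fib+maxWeight*≤ zero    _     = z≤n
fib+maxWeight*≤ (suc b) fib≤m = +-monoˡ-≤ _ fib≤m

levels : ℕ → ℕ → List ℕ
levels m zero          = []
levels m (suc zero)    = row m 1
levels m (suc (suc b)) = row m (2 + b) ++ levels m b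

alternateFibSum : ℕ → ℕ
alternateFibSum zero          = 0
alternateFibSum (suc zero)    = 1
alternateFibSum (suc (suc b)) = fib (2 + b) + alternateFibSum b

length-levels : ∀ m b → length (levels m b) ≡ alternateFibSum b
length-levels m zero          = refl
length-levels m (suc zero)    = refl
length-levels m (suc (suc b)) = begin-equality
  length (row m (2 + b) ++ levels m b)          ≡⟨ length-++ (row m (2 + b)) ⟩
  length (row m (2 + b)) + length (levels m b)  ≡⟨ cong₂ _+_ (length-row (2 + b)) (length-levels m b) ⟩
  fib (2 + b) + alternateFibSum b               ∎
  where
    length-row : ∀ b → length (row m b) ≡ fib b
    length-row b = trans (length-map _ (upTo (fib b))) (length-upTo (fib b))

levels⊆S : ∀ a b {z} → z ∈ levels (fib a) b → S a z
levels⊆S a zero          ()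
levels⊆S a (suc zero)    z∈ = row⊆S a 1 z∈
levels⊆S a (suc (suc b)) z∈ with ∈-++⁻ (row (fib a) (2 + b)) z∈
... | inj₁ z∈row    = row⊆S a (2 + b) z∈row
... | inj₂ z∈levels = levels⊆S a b z∈levels

levels-< : ∀ m b {z} → fib b ≤ m → z ∈ levels m b → z < fib b + maxWeight b * m
levels-< m zero          _     ()
levels-< m (suc zero)    _     z∈ = row-< m 1 z∈
levels-< m (suc (suc b)) fib≤m z∈ with ∈-++⁻ (row m (2 + b)) z∈
... | inj₁ z∈row    = row-< m (2 + b) z∈row
... | inj₂ z∈levels = begin-strict
  _                         <⟨ levels-< m b fib-b≤m z∈levels ⟩
  fib b + maxWeight b * m   ≤⟨ fib+maxWeight*≤ b fib-b≤m ⟩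
  maxWeight (2 + b) * m     ≤⟨ m≤n+m _ _ ⟩
  fib (2 + b) + maxWeight (2 + b) * m ∎
  where
    fib-b≤m : fib b ≤ m
    fib-b≤m = ≤-trans (fib-mono-≤ (m≤n+m b 2)) fib≤m

levels-unique : ∀ m b → fib b ≤ m → Unique (levels m b)
levels-unique m zero          _     = []
levels-unique m (suc zero)    _     = row-unique m 1
levels-unique m (suc (suc b)) fib≤m = ++⁺ (row-unique m (2 + b)) (levels-unique m b fib-b≤m) disjoint
  where
    fib-b≤m : fib b ≤ m
    fib-b≤m = ≤-trans (fib-mono-≤ (m≤n+m b 2)) fib≤m
    disjoint : ∀ {z} → ¬ (z ∈ row m (2 + b) × z ∈ levels m b)
    disjoint (z∈row , z∈levels) = <⇒≱ (levels-< m b fib-b≤m z∈levels)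
      (≤-trans (fib+maxWeight*≤ b fib-b≤m) (row-≥ m (2 + b) z∈row))

fib≤alternateFibSum+ : ∀ d → fib (5 + d) ≤ alternateFibSum (3 + d) + alternateFibSum (3 + d)
fib≤alternateFibSum+ zero          = n≤1+n 5
fib≤alternateFibSum+ (suc zero)    = ≤-refl
fib≤alternateFibSum+ (suc (suc d)) = begin
  fib (5 + d) + fib (4 + d) + fib (5 + d)  ≤⟨ +-monoˡ-≤ (fib (5 + d)) (+-monoʳ-≤ (fib (5 + d)) fib₄≤2A) ⟩
  fib (5 + d) + (A + A) + fib (5 + d)      ≡⟨ regroup (fib (5 + d)) A ⟩
  (fib (5 + d) + A) + (fib (5 + d) + A)    ∎
  where
    A = alternateFibSum (3 + d)
    fib₄≤2A : fib (4 + d) ≤ A + A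
    fib₄≤2A = ≤-trans (fib-≤-suc (4 + d)) (fib≤alternateFibSum+ d)
    regroup : ∀ F A → F + (A + A) + F ≡ (F + A) + (F + A)
    regroup = solve-∀

maxWeight*fib≤ : ∀ b → maxWeight (3 + b) * fib (3 + b) ≤ (2 + b) * alternateFibSum (1 + b)
maxWeight*fib≤ zero          = ≤-refl
maxWeight*fib≤ (suc zero)    = ≤-refl
maxWeight*fib≤ (suc (suc d)) = begin
  c * fib (5 + d)  ≤⟨ *-monoʳ-≤ c (fib≤alternateFibSum+ d) ⟩
  c * (A + A)      ≡⟨ *-distribˡ-+ c A A ⟩
  c * A + c * A    ≡⟨ *-distribʳ-+ A c c ⟨
  (c + c) * A      ≤⟨ *-monoˡ-≤ A (⌊n/2⌋+⌊n/2⌋≤n (4 + d)) ⟩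
  (4 + d) * A      ∎
  where
    c = maxWeight (5 + d)
    A = alternateFibSum (3 + d)

frobenius<maxWeight* : ∀ a {y} → IsFrobenius (S (suc a)) (+ y) → y < maxWeight (suc a) * fib (suc a)
frobenius<maxWeight* a (y∉S , _) = ≰⇒> λ c*m≤y → y∉S (_ , refl , S-≥maxWeight* a c*m≤y)

frobenius≥ : ∀ b {y} → IsFrobenius (S (3 + b)) (+ y) →
             fib (3 + b) ∸ 1 + maxWeight (1 + b) * fib (3 + b) ≤ y
frobenius≥ b (_ , >y⇒S) = ≮⇒≥ λ y<T → S-∌frobenius b (InZ-+ (>y⇒S (+ _) (ℤ.+<+ y<T)))

smallElementsCount≥ : ∀ b {y n} → IsFrobenius (S (3 + b)) (+ y) →
                      IsSmallElementsCount (S (3 + b)) (+ y) n → alternateFibSum (1 + b) ≤ n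
smallElementsCount≥ b {y} frobenius (L , _ , L-enumerates , refl) =
  subst (_≤ length L) (length-levels m (1 + b))
    (Unique-⊆⇒length≤ (levels-unique m (1 + b) fib≤m)
      (λ z∈ → Equivalence.from (L-enumerates _) (levels⊆S (3 + b) (1 + b) z∈ , ℤ.+<+ (levels<y z∈))))
  where
    m = fib (3 + b)
    fib≤m : fib (1 + b) ≤ m
    fib≤m = fib-mono-≤ (m≤n+m (1 + b) 2)
    fib≤m∸1 : fib (1 + b) ≤ m ∸ 1
    fib≤m∸1 = m+n≤o⇒m≤o∸n (fib (1 + b))
                (subst (_≤ m) (+-comm 1 _) (+-monoˡ-≤ (fib (1 + b)) (fib-suc-pos (suc b))))
    levels<y : ∀ {z} → z ∈ levels m (1 + b) → z < y
    levels<y {z} z∈ = begin-strict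
      z                                    <⟨ levels-< m (1 + b) fib≤m z∈ ⟩
      fib (1 + b) + maxWeight (1 + b) * m  ≤⟨ +-monoˡ-≤ _ fib≤m∸1 ⟩
      m ∸ 1 + maxWeight (1 + b) * m        ≤⟨ frobenius≥ b frobenius ⟩
      y                                    ∎

corollary36 : ∀ (a : ℕ) (F : ℤ) (e n : ℕ) →
    IsFrobenius (S a) F →
    IsEmbeddingDimension (S a) e →
    IsSmallElementsCount (S a) F n →
    F ℤ.+ + 1 ℤ.≤ + (e * n)
corollary36 a -[1+ k ] e n _ _ _ =
  subst (ℤ._≤ + (e * n)) (ℤ.+-comm (+ 1) -[1+ k ]) (ℤ.i<j⇒suc[i]≤j (ℤ.-<+ {k} {e * n}))
corollary36 0 (+ y) _ _ (y∉S , _) _ _ = contradiction (y , refl , Gen-all (1 , refl) y) y∉S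
corollary36 1 (+ y) _ _ (y∉S , _) _ _ = contradiction (y , refl , Gen-all (0 , refl) y) y∉S
corollary36 2 (+ y) _ _ (y∉S , _) _ _ = contradiction (y , refl , Gen-all (0 , refl) y) y∉S
corollary36 (suc (suc (suc b))) (+ y) e n frobenius dimension count = ℤ.+≤+ (begin
  y + 1                                ≡⟨ +-comm y 1 ⟩
  suc y                                ≤⟨ frobenius<maxWeight* (2 + b) frobenius ⟩
  maxWeight (3 + b) * fib (3 + b)      ≤⟨ maxWeight*fib≤ b ⟩
  (2 + b) * alternateFibSum (1 + b)    ≤⟨ *-mono-≤ (embeddingDimension≥ (suc b) dimension)
                                                   (smallElementsCount≥ b frobenius count) ⟩
  e * n                                ∎)
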